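{- Let $\mathbf L=(L,\vee,\wedge)$ be a distributive lattice and $a\in L$, and assume that the poset $\big(P_{\{a\}}(\mathbf L),\sqsubseteq\big)$ has no three-element antichain. Then $a$ is comparable with every element of $L$, and $a$ is join-irreducible and meet-irreducible.
   Context: For a lattice $\mathbf L$ and $S\subseteq L$, $P_S(\mathbf L):=\{(x,y)\in L^2\mid x\wedge y\leq z\leq x\vee y\text{ for all }z\in S\}$, ordered by $(x,y)\sqsubseteq(z,v)$ iff $x\leq z$ and $v\leq y$. An element $a$ is join-irreducible if there are no $c,d\in L\setminus\{a\}$ with $c\vee d=a$, and meet-irreducible if there are no $e,f\in L\setminus\{a\}$ with $e\wedge f=a$. -}

module Defs where

open import Level using (Level; _⊔_)
open import Data.Product using (Σ; _×_; _,_; ∃; ∃-syntax)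
open import Relation.Nullary using (¬_)
open import Algebra.Lattice.Bundles using (DistributiveLattice)

module _ {c ℓ : Level} (𝐋 : DistributiveLattice c ℓ) where
  open DistributiveLattice 𝐋

  _≤L_ : Carrier → Carrier → Set ℓ
  x ≤L y = (x ∧ y) ≈ x

  Comparable : Carrier → Carrier → Set ℓ
  Comparable x y = ¬ ¬ ((x ≤L y) Data.Sum.⊎ (y ≤L x))
    where import Data.Sum

  JoinIrreducible : Carrier → Set (c ⊔ ℓ)
  JoinIrreducible a = ¬ (Σ Carrier λ u → Σ Carrier λ v →
                          (¬ (u ≈ a)) × (¬ (v ≈ a)) × ((u ∨ v) ≈ a))

  MeetIrreducible : Carrier → Set (c ⊔ ℓ)
  MeetIrreducible a = ¬ (Σ Carrier λ u → Σ Carrier λ v →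
                          (¬ (u ≈ a)) × (¬ (v ≈ a)) × ((u ∧ v) ≈ a))

  InP : Carrier → Carrier × Carrier → Set ℓ
  InP a (x , y) = ((x ∧ y) ≤L a) × (a ≤L (x ∨ y))

  _⊑_ : Carrier × Carrier → Carrier × Carrier → Set ℓ
  (x , y) ⊑ (z , v) = (x ≤L z) × (v ≤L y)

  Incomparable⊑ : Carrier × Carrier → Carrier × Carrier → Set ℓ
  Incomparable⊑ p q = (¬ (p ⊑ q)) × (¬ (q ⊑ p))

  HasThreeAntichain : Carrier → Set (c ⊔ ℓ)
  HasThreeAntichain a =
    Σ (Carrier × Carrier) λ p → Σ (Carrier × Carrier) λ q → Σ (Carrier × Carrier) λ r →
      InP a p × InP a q × InP a r ×
      Incomparable⊑ p q × Incomparable⊑ p r × Incomparable⊑ q r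

{-# OPTIONS --safe #-}
-- If u and v are incomparable and (u , v) ∈ P_{a}, then (a , a), (u , v), (v , u) is a
-- three-element antichain: (u , v) and (v , u) are ⊑-comparable only if u and v are, and (a , a) is
-- ⊑-comparable with either only if u ≤ a ≤ v or v ≤ a ≤ u. An element x incomparable with a
-- yields the pair (x , a), and a decomposition u ∨ v ≈ a or u ∧ v ≈ a with u, v ≉ a forces
-- u and v to be incomparable.
module Submission where

open import Defs
open import Level using (Level)
open import Data.Product using (_×_; _,_; proj₁)
open import Data.Sum using (inj₁; inj₂)
open import Function using (_∘_)
open import Relation.Nullary using (¬_)
open import Algebra.Lattice.Bundles using (DistributiveLattice)
import Algebra.Lattice.Properties.Lattice as LatticeProperties
import Relation.Binary.Lattice as OrderTheoretic
import Relation.Binary.Lattice.Properties.JoinSemilattice as JoinSemilatticeProperties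

module _ {c ℓ : Level} (𝐋 : DistributiveLattice c ℓ) where
  open DistributiveLattice 𝐋

  private
    module O = OrderTheoretic.Lattice (LatticeProperties.∨-∧-orderTheoreticLattice lattice)
    module J = JoinSemilatticeProperties O.joinSemilattice

  _≤_ : Carrier → Carrier → Set ℓ
  _≤_ = _≤L_ 𝐋

  -- The library's order is x ≈ x ∧ y, whereas _≤L_ is x ∧ y ≈ x; hence the sym in each transfer.
  ≤-reflexive : ∀ {x y} → x ≈ y → x ≤ y
  ≤-reflexive = sym ∘ O.reflexive

  ≤-trans : ∀ {x y z} → x ≤ y → y ≤ z → x ≤ z
  ≤-trans p q = sym (O.trans (sym p) (sym q))

  ≤-respˡ-≈ : ∀ {x y z} → x ≈ y → x ≤ z → y ≤ z
  ≤-respˡ-≈ e p = sym (O.≤-respˡ-≈ e (sym p))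

  ≤-respʳ-≈ : ∀ {x y z} → x ≈ y → z ≤ x → z ≤ y
  ≤-respʳ-≈ e p = sym (O.≤-respʳ-≈ e (sym p))

  x∧y≤x : ∀ x y → (x ∧ y) ≤ x
  x∧y≤x x y = sym (O.x∧y≤x x y)

  x∧y≤y : ∀ x y → (x ∧ y) ≤ y
  x∧y≤y x y = sym (O.x∧y≤y x y)

  x≤x∨y : ∀ x y → x ≤ (x ∨ y)
  x≤x∨y x y = sym (O.x≤x∨y x y)

  y≤x∨y : ∀ x y → y ≤ (x ∨ y)
  y≤x∨y x y = sym (O.y≤x∨y x y)

  x≤y⇒x∨y≈y : ∀ {x y} → x ≤ y → (x ∨ y) ≈ y
  x≤y⇒x∨y≈y = J.x≤y⇒x∨y≈y ∘ sym

  diagonal∈P : ∀ a → InP 𝐋 a (a , a)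
  diagonal∈P a = x∧y≤x a a , x≤x∨y a a

  InP-swap : ∀ {a x y} → InP 𝐋 a (x , y) → InP 𝐋 a (y , x)
  InP-swap {x = x} {y} (x∧y≤a , a≤x∨y) = ≤-respˡ-≈ (∧-comm x y) x∧y≤a , ≤-respʳ-≈ (∨-comm x y) a≤x∨y

  incomparable∈P⇒threeAntichain : ∀ {a u v} → InP 𝐋 a (u , v) → ¬ (u ≤ v) → ¬ (v ≤ u) →
                                  HasThreeAntichain 𝐋 a
  incomparable∈P⇒threeAntichain {a} {u} {v} uv∈P u≰v v≰u =
    (a , a) , (u , v) , (v , u) ,
    diagonal∈P a , uv∈P , InP-swap uv∈P ,
    ((λ (a≤u , v≤a) → v≰u (≤-trans v≤a a≤u)) , (λ (u≤a , a≤v) → u≰v (≤-trans u≤a a≤v))) ,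
    ((λ (a≤v , u≤a) → u≰v (≤-trans u≤a a≤v)) , (λ (v≤a , a≤u) → v≰u (≤-trans v≤a a≤u))) ,
    (u≰v ∘ proj₁ , v≰u ∘ proj₁)

  ¬threeAntichain⇒comparable : ∀ {a} → ¬ HasThreeAntichain 𝐋 a → ∀ x → Comparable 𝐋 a x
  ¬threeAntichain⇒comparable {a} noAntichain x incomparable =
    noAntichain (incomparable∈P⇒threeAntichain (x∧y≤y x a , y≤x∨y x a)
                                               (incomparable ∘ inj₂) (incomparable ∘ inj₁))

  ¬threeAntichain⇒joinIrreducible : ∀ {a} → ¬ HasThreeAntichain 𝐋 a → JoinIrreducible 𝐋 a
  ¬threeAntichain⇒joinIrreducible {a} noAntichain (u , v , u≉a , v≉a , u∨v≈a) =
    noAntichain (incomparable∈P⇒threeAntichain (≤-trans (x∧y≤x u v) u≤a , ≤-reflexive (sym u∨v≈a))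
                                               u≰v v≰u)
    where
    u≤a : u ≤ a
    u≤a = ≤-respʳ-≈ u∨v≈a (x≤x∨y u v)

    u≰v : ¬ (u ≤ v)
    u≰v u≤v = v≉a (trans (sym (x≤y⇒x∨y≈y u≤v)) u∨v≈a)

    v≰u : ¬ (v ≤ u)
    v≰u v≤u = u≉a (trans (sym (x≤y⇒x∨y≈y v≤u)) (trans (∨-comm v u) u∨v≈a))

  ¬threeAntichain⇒meetIrreducible : ∀ {a} → ¬ HasThreeAntichain 𝐋 a → MeetIrreducible 𝐋 a
  ¬threeAntichain⇒meetIrreducible {a} noAntichain (u , v , u≉a , v≉a , u∧v≈a) =
    noAntichain (incomparable∈P⇒threeAntichain (≤-reflexive u∧v≈a , ≤-trans a≤u (x≤x∨y u v))
                                               u≰v v≰u)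
    where
    a≤u : a ≤ u
    a≤u = ≤-respˡ-≈ u∧v≈a (x∧y≤x u v)

    u≰v : ¬ (u ≤ v)
    u≰v u≤v = u≉a (trans (sym u≤v) u∧v≈a)

    v≰u : ¬ (v ≤ u)
    v≰u v≤u = v≉a (trans (sym v≤u) (trans (∧-comm v u) u∧v≈a))

lemma28 : {c ℓ : Level} (𝐋 : DistributiveLattice c ℓ) (a : DistributiveLattice.Carrier 𝐋) →
          ¬ HasThreeAntichain 𝐋 a →
          ((x : DistributiveLattice.Carrier 𝐋) → Comparable 𝐋 a x) ×
          JoinIrreducible 𝐋 a × MeetIrreducible 𝐋 a
lemma28 𝐋 a noAntichain =
  ¬threeAntichain⇒comparable 𝐋 noAntichain ,
  ¬threeAntichain⇒joinIrreducible 𝐋 noAntichain ,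
  ¬threeAntichain⇒meetIrreducible 𝐋 noAntichain
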